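{- Let $N$ be a network with $n$ boundary vertices and excedance $k$, let $r\ge1$, and let $\lambda$ be integers with $0\le\lambda_i\le r$, $\sum\lambda_i=kr$. Let $\mathcal S=(S_1,\dots,S_n)$ be a list of boundary label subsets of type $\lambda$ and let $(I_1,\dots,I_r)$ be its dual list, $I_i=\{j\in[n]: i\in S_j\}$. Then $$\Delta_{I_1}(N)\cdots\Delta_{I_r}(N)=\mathrm{sign}(\mathcal S)\,\mathrm{Web}_r(N;\lambda)(E_{\mathcal S}).$$
   Context: Networks. A network $N$ is a finite planar bipartite graph $G$ in a closed disk (vertices black/white, edges joining different colors) with nonzero complex edge weights $\mathrm{wt}(e)$; $n$ black boundary vertices labeled $1,\dots,n$ counterclockwise, boundary vertex $i$ incident to at most one edge $b_i$; other vertices interior. A dimer configuration $\pi$ covers each interior vertex exactly once and each boundary vertex at most once; $\partial(\pi)$ is the set of covered boundary vertices, of size $k$ = #interior white − #interior black vertices (the excedance). $\Delta_I(N)=\sum_{\partial(\pi)=I}\prod_{e\in\pi}\mathrm{wt}(e)$. Standing assumption: $N$ has at least one dimer configuration. $U=\mathbb C^r$ with basis $E_1,\dots,E_r$ and $\bigwedge^rU\cong\mathbb C$ via $E_1\wedge\cdots\wedge E_r\mapsto1$; $\mathcal W_\lambda(U)=\mathrm{Hom}_{\mathrm{SL}(U)}(\bigotimes_i\bigwedge^{\lambda_i}U,\mathbb C)$. A list of boundary label subsets of type $\lambda$ is $\mathcal S=(S_1,\dots,S_n)$ with $S_j\subset[r]$, $|S_j|=\lambda_j$, each $i\in[r]$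 lying in exactly $k$ of the $S_j$; $E_{\mathcal S}=E_{S_1}\otimes\cdots\otimes E_{S_n}$ where $E_S$ is the increasing wedge of the $E_i$, $i\in S$; $\mathrm{sign}(\mathcal S)=(-1)^{\mathrm{inv}}$, $\mathrm{inv}$ the number of pairs $p<q$ with $w_p>w_q$ in the concatenation $w$ of the increasing listings of $S_1,\dots,S_n$. An $r$-weblike subgraph $W$ of $G$: edges with multiplicities $m(e)\in[r]$ summing to $r$ at each interior vertex; $\mathrm{wt}(W)=\prod\mathrm{wt}(e)^{m(e)}$; degree $\lambda(W)=(m(b_1),\dots,m(b_n))$ ($0$ if $b_j\notin W$). A consistent labeling assigns $S(e)\subset[r]$, $|S(e)|=m(e)$, pairwise disjoint with union $[r]$ at each interior vertex; $a(\mathcal S;W)$ counts consistent labelings with $S(b_j)=S_j$. $\mathbf W\in\mathcal W_\lambda(U)$ is the unique element with $\mathbf W(E_{\mathcal S})=\mathrm{sign}(\mathcal S)a(\mathcal S;W)$ for all lists $\mathcal S$ of type $\lambda$ (it exists and is unique). $\mathrm{Web}_r(N;\lambda)=\sum_{W:\lambda(W)=\lambda}\mathrm{wt}(W)\mathbf W$. -}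

module Defs where

open import Level using (Level; _⊔_)
open import Function using (_∘_)
open import Data.Bool using (Bool; true; false; _∧_; not; if_then_else_)
open import Data.Nat using (ℕ; zero; suc; _≤_) renaming (_+_ to _+ℕ_; _*_ to _*ℕ_)
import Data.Nat as ℕ
open import Data.Fin using (Fin; zero; suc; toℕ)
import Data.Fin as F
open import Data.Sum using (_⊎_; inj₁; inj₂)
open import Data.Product using (Σ; _×_; _,_)
open import Data.List using (List; []; _∷_; map; concatMap; foldr; _++_; allFin)
open import Relation.Nullary using (¬_)
open import Relation.Nullary.Decidable using (⌊_⌋)
open import Relation.Binary.PropositionalEquality using (_≡_)
open import Algebra.Bundles using (CommutativeRing)

count : ∀ {m} → (Fin m → Bool) → ℕ
count {zero}  f = 0
count {suc m} f = (if f zero then 1 else 0) +ℕ count (λ i → f (suc i))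

sumℕ : ∀ {m} → (Fin m → ℕ) → ℕ
sumℕ {zero}  f = 0
sumℕ {suc m} f = f zero +ℕ sumℕ (λ i → f (suc i))

allB : ∀ {m} → (Fin m → Bool) → Bool
allB {zero}  f = true
allB {suc m} f = f zero ∧ allB (λ i → f (suc i))

countL : ∀ {a} {A : Set a} → List A → (A → Bool) → ℕ
countL []       p = 0
countL (x ∷ xs) p = (if p x then 1 else 0) +ℕ countL xs p

_==_ : ℕ → ℕ → Bool
m == n = ⌊ m ℕ.≟ n ⌋

_≤ᵇ_ : ℕ → ℕ → Bool
m ≤ᵇ n = ⌊ m ℕ.≤? n ⌋

allFuns : ∀ {a} {A : Set a} (m : ℕ) → List A → List (Fin m → A)
allFuns zero    xs = (λ ()) ∷ []
allFuns (suc m) xs =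
  concatMap (λ x → map (λ g → λ { zero → x ; (suc i) → g i }) (allFuns m xs)) xs

Sub : ℕ → Set
Sub m = Fin m → Bool

allSubs : (m : ℕ) → List (Sub m)
allSubs m = allFuns m (true ∷ false ∷ [])

eqSub : ∀ {m} → Sub m → Sub m → Bool
eqSub A B = allB (λ i → eqB (A i) (B i))
  where
  eqB : Bool → Bool → Bool
  eqB true  b = b
  eqB false b = not b

listing : ∀ {m} → Sub m → List (Fin m)
listing {zero}  S = []
listing {suc m} S = (if S zero then zero ∷ [] else []) ++ map suc (listing (S ∘ suc))

concatFam : ∀ {a} {A : Set a} {n} → (Fin n → List A) → List A
concatFam {n = zero}  f = []
concatFam {n = suc n} f = f zero ++ concatFam (f ∘ suc)

inv : ∀ {r} → List (Fin r) → ℕ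
inv []       = 0
inv (x ∷ xs) = countL xs (λ y → ⌊ y F.<? x ⌋) +ℕ inv xs

module RingOps {c ℓ} (R : CommutativeRing c ℓ) where
  open CommutativeRing R using (Carrier; _+_; _*_; -_; 0#; 1#)

  sumList : ∀ {a} {A : Set a} → List A → (A → Carrier) → Carrier
  sumList []       f = 0#
  sumList (x ∷ xs) f = f x + sumList xs f

  prodFin : ∀ {m} → (Fin m → Carrier) → Carrier
  prodFin {zero}  f = 1#
  prodFin {suc m} f = f zero * prodFin (λ i → f (suc i))

  pow : Carrier → ℕ → Carrier
  pow x zero    = 1#
  pow x (suc k) = x * pow x k

  fromℕ : ℕ → Carrier
  fromℕ zero    = 0#
  fromℕ (suc k) = 1# + fromℕ k

  sgn : ℕ → Carrier
  sgn zero    = 1#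
  sgn (suc k) = - sgn k

-- A bipartite graph with edge weights in R. Vertices:
--   * boundary vertices Fin n (black),
--   * interior black vertices Fin nB,
--   * interior white vertices Fin nW.
-- Edges Fin nE (multiple edges allowed); each edge joins its white
-- endpoint (all white vertices are interior) to its black endpoint
-- (boundary or interior).  Planar embedding data is NOT recorded
--.

isBd : ∀ {n nB} → Fin n ⊎ Fin nB → Fin n → Bool
isBd (inj₁ i) j = ⌊ i F.≟ j ⌋
isBd (inj₂ _) j = false

isIntB : ∀ {n nB} → Fin n ⊎ Fin nB → Fin nB → Bool
isIntB (inj₁ _) v = false
isIntB (inj₂ u) v = ⌊ u F.≟ v ⌋

record Network {c ℓ} (R : CommutativeRing c ℓ) (n : ℕ) : Set (c ⊔ ℓ) where
  open CommutativeRing R using (Carrier; _≈_; 0#)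
  field
    nB nW nE : ℕ
    white : Fin nE → Fin nW
    black : Fin nE → Fin n ⊎ Fin nB
    wt    : Fin nE → Carrier
    wt≉0  : ∀ e → ¬ (wt e ≈ 0#)

    bdry≤1 : ∀ j → count (λ e → isBd (black e) j) ≤ 1

module _ {c ℓ} {R : CommutativeRing c ℓ} {n : ℕ} (N : Network R n) where
  open CommutativeRing R using (Carrier; _+_; _*_; 0#; 1#)
  open RingOps R
  open Network N

  incW : Fin nE → Fin nW → Bool
  incW e v = ⌊ white e F.≟ v ⌋

  incB : Fin nE → Fin nB → Bool
  incB e v = isIntB (black e) v

  incBd : Fin nE → Fin n → Bool
  incBd e j = isBd (black e) j

  isDimer : Sub nE → Bool
  isDimer π =
    allB (λ v → count (λ e → π e ∧ incW e v) == 1) ∧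
    (allB (λ v → count (λ e → π e ∧ incB e v) == 1) ∧
     allB (λ j → count (λ e → π e ∧ incBd e j) ≤ᵇ 1))

  IsDimer : Sub nE → Set
  IsDimer π = isDimer π ≡ true

  HasDimer : Set
  HasDimer = Σ (Sub nE) IsDimer

  ∂ : Sub nE → Sub n
  ∂ π j = not (count (λ e → π e ∧ incBd e j) == 0)

  wtSet : Sub nE → Carrier
  wtSet π = prodFin (λ e → if π e then wt e else 1#)

  Δ : Sub n → Carrier
  Δ I = sumList (allSubs nE)
          (λ π → if isDimer π ∧ eqSub (∂ π) I then wtSet π else 0#)

  -- r-weblike subgraphs, encoded by their multiplicity function
  -- M : edges → {0,…,r}  (M e = 0 means e ∉ W, otherwise m(e) = M e ∈ [r]).

  module _ (r : ℕ) where

    Mult : Set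
    Mult = Fin nE → Fin (suc r)

    mult : Mult → Fin nE → ℕ
    mult M e = toℕ (M e)

    isWeblike : Mult → Bool
    isWeblike M =
      allB (λ v → sumℕ (λ e → if incW e v then mult M e else 0) == r) ∧
      allB (λ v → sumℕ (λ e → if incB e v then mult M e else 0) == r)

    wtW : Mult → Carrier
    wtW M = prodFin (λ e → pow (wt e) (mult M e))

    degW : Mult → Fin n → ℕ
    degW M j = sumℕ (λ e → if incBd e j then mult M e else 0)

    -- consistent labelings L : edges → subsets of [r] with |L e| = m(e),
    -- and at every interior vertex the labels of incident edges pairwise
    -- disjoint with union [r], i.e. every i ∈ [r] lies in exactly one of them.
    isConsistent : Mult → (Fin nE → Sub r) → Bool
    isConsistent M L =
      allB (λ e → count (L e) == mult M e) ∧
      (allB (λ v → allB (λ i → count (λ e → incW e v ∧ L e i) == 1)) ∧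
       allB (λ v → allB (λ i → count (λ e → incB e v ∧ L e i) == 1)))

    matchesBdry : (Fin n → Sub r) → (Fin nE → Sub r) → Bool
    matchesBdry S L =
      allB (λ j → allB (λ e → if incBd e j then eqSub (L e) (S j) else true))

    aCount : (Fin n → Sub r) → Mult → ℕ
    aCount S M = countL (allFuns nE (allSubs r))
                   (λ L → isConsistent M L ∧ matchesBdry S L)

    signL : (Fin n → Sub r) → Carrier
    signL S = sgn (inv (concatFam (λ j → listing (S j))))

    -- 𝐖(E_S) := sign(S) a(S;W)   (the defining property of 𝐖)
    webVal : Mult → (Fin n → Sub r) → Carrier
    webVal M S = signL S * fromℕ (aCount S M)

    eqDeg : (Fin n → ℕ) → (Fin n → ℕ) → Bool
    eqDeg f g = allB (λ j → f j == g j)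

    WebEval : (Fin n → ℕ) → (Fin n → Sub r) → Carrier
    WebEval lam S =
      sumList (allFuns nE (allFin (suc r)))
        (λ M → if isWeblike M ∧ eqDeg (degW M) lam then wtW M * webVal M S else 0#)

IsListOfType : ∀ {n r} → (Fin n → Sub r) → (Fin n → ℕ) → ℕ → Set
IsListOfType {n} {r} S lam k =
  (∀ j → count (S j) ≡ lam j) × (∀ i → count (λ j → S j i) ≡ k)

dual : ∀ {n r} → (Fin n → Sub r) → Fin r → Sub n
dual S i j = S j i

module Submission where

-- Expanding the product of the r sums Δ_{I_i}(N) gives a sum over r-tuples
-- (π_1,…,π_r) of edge sets; a tuple contributes ∏_i wt(π_i) when every π_i
-- is a dimer configuration with ∂π_i = I_i, and 0 otherwise.  Transposing a
-- tuple gives the edge labeling L(e) = {i : e ∈ π_i} by subsets of [r], and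
-- the tuple contributes exactly when L is a consistent labeling, agreeing
-- with S on the boundary, of the r-weblike subgraph W with multiplicities
-- m(e) = |L(e)| and degree λ; in that case ∏_i wt(π_i) = wt(W).  Grouping
-- the labelings by their subgraph W turns the sum into Σ_W wt(W)·a(S;W),
-- which is sign(S)·Web_r(N;λ)(E_S) because sign(S)² = 1.

open import Defs
open import Function using (_∘_)
open import Data.Bool using (Bool; true; false; _∧_; not; if_then_else_)
open import Data.Bool.Properties using (∧-conicalˡ; ∧-conicalʳ)
open import Data.Nat using (ℕ; zero; suc; _≤_; z≤n; s≤s)
import Data.Nat as ℕ
open import Data.Fin using (Fin; zero; suc; toℕ)
open import Data.List using (List; []; _∷_; map; concatMap; _++_; allFin; tabulate)
open import Data.Sum using (_⊎_; inj₁; inj₂)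
open import Data.Product using (Σ; _×_; _,_; proj₁; proj₂)
open import Data.Empty using (⊥-elim)
open import Relation.Nullary using (¬_; Dec; yes; no)
open import Relation.Nullary.Decidable using (⌊_⌋)
open import Relation.Binary.PropositionalEquality as P using (_≡_; refl; cong; cong₂)
open import Algebra.Bundles using (CommutativeRing)

⌊⌋-true⇒ : ∀ {p} {P : Set p} (d : Dec P) → ⌊ d ⌋ ≡ true → P
⌊⌋-true⇒ (yes p) _ = p

⇒⌊⌋-true : ∀ {p} {P : Set p} (d : Dec P) → P → ⌊ d ⌋ ≡ true
⇒⌊⌋-true (yes _) _ = refl
⇒⌊⌋-true (no ¬p) p = ⊥-elim (¬p p)

==⇒≡ : ∀ {m n} → (m == n) ≡ true → m ≡ n
==⇒≡ {m} {n} = ⌊⌋-true⇒ (m ℕ.≟ n)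

≡⇒== : ∀ {m n} → m ≡ n → (m == n) ≡ true
≡⇒== {m} {n} = ⇒⌊⌋-true (m ℕ.≟ n)

≤⇒≤ᵇ : ∀ {m n} → m ≤ n → (m ≤ᵇ n) ≡ true
≤⇒≤ᵇ {m} {n} = ⇒⌊⌋-true (m ℕ.≤? n)

∧-intro : ∀ {a b} → a ≡ true → b ≡ true → (a ∧ b) ≡ true
∧-intro refl refl = refl

∧-elimˡ : ∀ {a b} → (a ∧ b) ≡ true → a ≡ true
∧-elimˡ {a} {b} = ∧-conicalˡ a b

∧-elimʳ : ∀ {a b} → (a ∧ b) ≡ true → b ≡ true
∧-elimʳ {a} {b} = ∧-conicalʳ a b

true≢false : ¬ (true ≡ false)
true≢false ()

¬true⇒false : ∀ {b} → ¬ (b ≡ true) → b ≡ false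
¬true⇒false {true}  h = ⊥-elim (h refl)
¬true⇒false {false} _ = refl

if-true⇒ : ∀ {b x} → b ≡ true → (if b then x else true) ≡ true → x ≡ true
if-true⇒ refl h = h

allB-elim : ∀ {m} {f : Fin m → Bool} → allB f ≡ true → ∀ i → f i ≡ true
allB-elim {suc m} {f} h zero    = ∧-elimˡ {f zero} h
allB-elim {suc m} {f} h (suc i) = allB-elim {m} (∧-elimʳ {f zero} h) i

allB-intro : ∀ {m} {f : Fin m → Bool} → (∀ i → f i ≡ true) → allB f ≡ true
allB-intro {zero}  h = refl
allB-intro {suc m} h = ∧-intro (h zero) (allB-intro (h ∘ suc))

allB-cong : ∀ {m} {f g : Fin m → Bool} → (∀ i → f i ≡ g i) → allB f ≡ allB g
allB-cong {zero}  h = refl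
allB-cong {suc m} h = cong₂ _∧_ (h zero) (allB-cong (h ∘ suc))

eqSub-elim : ∀ {m} {A B : Sub m} → eqSub A B ≡ true → ∀ i → A i ≡ B i
eqSub-elim {A = A} {B} h i with A i | B i | allB-elim h i
... | true  | true  | _ = refl
... | false | false | _ = refl

eqSub-intro : ∀ {m} {A B : Sub m} → (∀ i → A i ≡ B i) → eqSub A B ≡ true
eqSub-intro {zero}  h = refl
eqSub-intro {suc m} {A} {B} h
  with A zero | B zero | h zero | eqSub-intro {m} {A ∘ suc} {B ∘ suc} (h ∘ suc)
... | true  | .true  | refl | rest = rest
... | false | .false | refl | rest = rest

module Counting where
  open import Data.Nat using (_+_)
  open import Data.Nat.Properties using (m≤n⇒m≤1+n; +-identityʳ; +-commutativeSemigroup)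
  open import Data.Fin.Properties using (suc-injective)
  open import Algebra.Properties.CommutativeSemigroup +-commutativeSemigroup using (interchange)

  ind : Bool → ℕ
  ind b = if b then 1 else 0

  count-cong : ∀ {m} {f g : Fin m → Bool} → (∀ i → f i ≡ g i) → count f ≡ count g
  count-cong {zero}  h = refl
  count-cong {suc m} h = cong₂ _+_ (cong ind (h zero)) (count-cong (h ∘ suc))

  count≤size : ∀ {m} (f : Fin m → Bool) → count f ≤ m
  count≤size {zero}  f = z≤n
  count≤size {suc m} f with f zero
  ... | true  = s≤s (count≤size (f ∘ suc))
  ... | false = m≤n⇒m≤1+n (count≤size (f ∘ suc))

  count-mono : ∀ {m} {f g : Fin m → Bool} → (∀ i → f i ≡ true → g i ≡ true) → count f ≤ count g
  count-mono {zero}  h = z≤n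
  count-mono {suc m} {f} {g} h with f zero in ef | g zero in eg
  ... | true  | true  = s≤s (count-mono (h ∘ suc))
  ... | true  | false with () ← P.trans (P.sym (h zero ef)) eg
  ... | false | true  = m≤n⇒m≤1+n (count-mono (h ∘ suc))
  ... | false | false = count-mono (h ∘ suc)

  count-pos : ∀ {m} {f : Fin m → Bool} i → f i ≡ true → 1 ≤ count f
  count-pos {suc m} {f} zero t rewrite t = s≤s z≤n
  count-pos {suc m} {f} (suc i) t with f zero
  ... | true  = s≤s z≤n
  ... | false = count-pos {f = f ∘ suc} i t

  count-allFalse : ∀ {m} {f : Fin m → Bool} → (∀ i → f i ≡ false) → count f ≡ 0
  count-allFalse {zero}  h = refl
  count-allFalse {suc m} h rewrite h zero = count-allFalse (h ∘ suc)

  count≡0⇒false : ∀ {m} {f : Fin m → Bool} → count f ≡ 0 → ∀ i → f i ≡ false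
  count≡0⇒false {f = f} c i = ¬true⇒false λ t → 1≰0 (P.subst (1 ≤_) c (count-pos {f = f} i t))
    where
    1≰0 : ¬ (1 ≤ 0)
    1≰0 ()

  second-witness : ∀ {x} → 1 ≤ x → ¬ (suc x ≤ 1)
  second-witness (s≤s _) (s≤s ())

  count≤1⇒unique : ∀ {m} {f : Fin m → Bool} → count f ≤ 1 →
                   ∀ a b → f a ≡ true → f b ≡ true → a ≡ b
  count≤1⇒unique {suc m} {f} c zero zero _ _ = refl
  count≤1⇒unique {suc m} {f} c zero (suc b) ta tb rewrite ta =
    ⊥-elim (second-witness (count-pos {f = f ∘ suc} b tb) c)
  count≤1⇒unique {suc m} {f} c (suc a) zero ta tb rewrite tb =
    ⊥-elim (second-witness (count-pos {f = f ∘ suc} a ta) c)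
  count≤1⇒unique {suc m} {f} c (suc a) (suc b) ta tb with f zero
  ... | true  = ⊥-elim (second-witness (count-pos {f = f ∘ suc} a ta) c)
  ... | false = cong suc (count≤1⇒unique c a b ta tb)

  nonzero⇒not==0 : ∀ {x} → 1 ≤ x → not (x == 0) ≡ true
  nonzero⇒not==0 {suc x} _ = refl

  find : ∀ {m} (p : Fin m → Bool) → (Σ (Fin m) λ i → p i ≡ true) ⊎ (∀ i → p i ≡ false)
  find {zero}  p = inj₂ λ ()
  find {suc m} p with p zero in e
  ... | true  = inj₁ (zero , e)
  ... | false with find (p ∘ suc)
  ...   | inj₁ (i , t) = inj₁ (suc i , t)
  ...   | inj₂ none    = inj₂ λ { zero → e ; (suc i) → none i }

  sumℕ-cong : ∀ {m} {f g : Fin m → ℕ} → (∀ i → f i ≡ g i) → sumℕ f ≡ sumℕ g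
  sumℕ-cong {zero}  h = refl
  sumℕ-cong {suc m} h = cong₂ _+_ (h zero) (sumℕ-cong (h ∘ suc))

  count≡sumℕ : ∀ {m} (f : Fin m → Bool) → count f ≡ sumℕ (ind ∘ f)
  count≡sumℕ {zero}  f = refl
  count≡sumℕ {suc m} f = cong (ind (f zero) +_) (count≡sumℕ (f ∘ suc))

  sumℕ-+ : ∀ {m} (f g : Fin m → ℕ) → sumℕ (λ i → f i + g i) ≡ sumℕ f + sumℕ g
  sumℕ-+ {zero}  f g = refl
  sumℕ-+ {suc m} f g = P.trans (cong (f zero + g zero +_) (sumℕ-+ (f ∘ suc) (g ∘ suc)))
                                (interchange (f zero) (g zero) _ _)

  sumℕ-zeros : ∀ {m} {f : Fin m → ℕ} → (∀ i → f i ≡ 0) → sumℕ f ≡ 0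
  sumℕ-zeros {zero}  h = refl
  sumℕ-zeros {suc m} h rewrite h zero = sumℕ-zeros (h ∘ suc)

  sumℕ-swap : ∀ {m k} (g : Fin m → Fin k → ℕ) →
              sumℕ (λ i → sumℕ (g i)) ≡ sumℕ (λ j → sumℕ (λ i → g i j))
  sumℕ-swap {zero}  {k} g = P.sym (sumℕ-zeros {k} λ _ → refl)
  sumℕ-swap {suc m} g = P.trans (cong (sumℕ (g zero) +_) (sumℕ-swap (g ∘ suc)))
                                (P.sym (sumℕ-+ (g zero) _))

  sumℕ-ones : ∀ {m} → sumℕ {m} (λ _ → 1) ≡ m
  sumℕ-ones {zero}  = refl
  sumℕ-ones {suc m} = cong suc sumℕ-ones

  sumℕ-filter-none : ∀ {m} {p : Fin m → Bool} (g : Fin m → ℕ) → (∀ i → p i ≡ false) →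
                     sumℕ (λ i → if p i then g i else 0) ≡ 0
  sumℕ-filter-none g h = sumℕ-zeros λ i → cong (λ b → if b then g i else 0) (h i)

  sumℕ-filter-single : ∀ {m} {p : Fin m → Bool} (g : Fin m → ℕ) i₀ → p i₀ ≡ true →
                       (∀ i → p i ≡ true → i ≡ i₀) → sumℕ (λ i → if p i then g i else 0) ≡ g i₀
  sumℕ-filter-single {suc m} {p} g zero t only rewrite t =
    P.trans (cong (g zero +_) (sumℕ-filter-none (g ∘ suc) λ i →
                                 ¬true⇒false λ ti → suc≢zero (only (suc i) ti)))
            (+-identityʳ (g zero))
    where
    suc≢zero : ∀ {i : Fin m} → ¬ (suc i ≡ zero)
    suc≢zero ()
  sumℕ-filter-single {suc m} {p} g (suc i₀) t only with p zero in p0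
  ... | true with () ← only zero p0
  ... | false = sumℕ-filter-single (g ∘ suc) i₀ t λ i ti → suc-injective (only (suc i) ti)

  if-count : ∀ {m} b (f : Fin m → Bool) → (if b then count f else 0) ≡ count (λ i → b ∧ f i)
  if-count true  f = refl
  if-count {m} false f = P.sym (count-allFalse {m} λ _ → refl)

open Counting

module RingSums {c ℓ} (R : CommutativeRing c ℓ) where
  open import Level using (_⊔_)
  open import Data.Fin.Properties using (suc-injective)
  open CommutativeRing R hiding (zero)
    renaming (refl to ≈-refl; sym to ≈-sym; trans to ≈-trans)
  open RingOps R
  open import Relation.Binary.Reasoning.Setoid setoid
  open import Algebra.Properties.Ring ring using (-‿distribˡ-*; -‿distribʳ-*; -‿involutive)
  open import Algebra.Properties.CommutativeSemigroup +-commutativeSemigroup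
    using () renaming (interchange to +-interchange)
  open import Algebra.Properties.CommutativeSemigroup *-commutativeSemigroup
    using () renaming (interchange to *-interchange)

  when : Bool → Carrier → Carrier
  when b x = if b then x else 0#

  when-true : ∀ {b x} → b ≡ true → when b x ≡ x
  when-true refl = refl

  when-false : ∀ {b x} → b ≡ false → when b x ≡ 0#
  when-false refl = refl

  when-cong : ∀ {b b′ x x′} → b ≡ b′ → x ≈ x′ → when b x ≈ when b′ x′
  when-cong {true}  refl x≈x′ = x≈x′
  when-cong {false} refl _    = ≈-refl

  sumList-cong : ∀ {A : Set} (xs : List A) {f g : A → Carrier} →
                 (∀ x → f x ≈ g x) → sumList xs f ≈ sumList xs g
  sumList-cong []       h = ≈-refl
  sumList-cong (x ∷ xs) h = +-cong (h x) (sumList-cong xs h)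

  sumList-zero : ∀ {A : Set} (xs : List A) {f : A → Carrier} → (∀ x → f x ≈ 0#) → sumList xs f ≈ 0#
  sumList-zero []       h = ≈-refl
  sumList-zero (x ∷ xs) h = ≈-trans (+-cong (h x) (sumList-zero xs h)) (+-identityʳ 0#)

  sumList-++ : ∀ {A : Set} (xs ys : List A) (f : A → Carrier) →
               sumList (xs ++ ys) f ≈ sumList xs f + sumList ys f
  sumList-++ []       ys f = ≈-sym (+-identityˡ _)
  sumList-++ (x ∷ xs) ys f = ≈-trans (+-cong ≈-refl (sumList-++ xs ys f)) (≈-sym (+-assoc _ _ _))

  sumList-map : ∀ {A B : Set} (F : A → B) (xs : List A) (h : B → Carrier) →
                sumList (map F xs) h ≈ sumList xs (h ∘ F)
  sumList-map F []       h = ≈-refl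
  sumList-map F (x ∷ xs) h = +-cong ≈-refl (sumList-map F xs h)

  sumList-concatMap : ∀ {A B C : Set} (xs : List A) (ys : List B) (F : A → B → C) (h : C → Carrier) →
                      sumList (concatMap (λ x → map (F x) ys) xs) h ≈
                      sumList xs (λ x → sumList ys (λ y → h (F x y)))
  sumList-concatMap []       ys F h = ≈-refl
  sumList-concatMap (x ∷ xs) ys F h =
    ≈-trans (sumList-++ (map (F x) ys) _ h)
            (+-cong (sumList-map (F x) ys h) (sumList-concatMap xs ys F h))

  sumList-+ : ∀ {A : Set} (xs : List A) (f g : A → Carrier) →
              sumList xs (λ x → f x + g x) ≈ sumList xs f + sumList xs g
  sumList-+ []       f g = ≈-sym (+-identityʳ 0#)
  sumList-+ (x ∷ xs) f g = ≈-trans (+-cong ≈-refl (sumList-+ xs f g)) (+-interchange _ _ _ _)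

  sumList-*ˡ : ∀ {A : Set} (xs : List A) (a : Carrier) (f : A → Carrier) →
               a * sumList xs f ≈ sumList xs (λ x → a * f x)
  sumList-*ˡ []       a f = zeroʳ a
  sumList-*ˡ (x ∷ xs) a f = ≈-trans (distribˡ a _ _) (+-cong ≈-refl (sumList-*ˡ xs a f))

  sumList-*ʳ : ∀ {A : Set} (xs : List A) (a : Carrier) (f : A → Carrier) →
               sumList xs f * a ≈ sumList xs (λ x → f x * a)
  sumList-*ʳ []       a f = zeroˡ a
  sumList-*ʳ (x ∷ xs) a f = ≈-trans (distribʳ a _ _) (+-cong ≈-refl (sumList-*ʳ xs a f))

  sumList-swap : ∀ {A B : Set} (xs : List A) (ys : List B) (f : A → B → Carrier) →
                 sumList xs (λ x → sumList ys (f x)) ≈ sumList ys (λ y → sumList xs (λ x → f x y))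
  sumList-swap []       ys f = ≈-sym (sumList-zero ys λ _ → ≈-refl)
  sumList-swap (x ∷ xs) ys f = ≈-trans (+-cong ≈-refl (sumList-swap xs ys f)) (≈-sym (sumList-+ ys _ _))

  *-fromℕ-countL : ∀ {A : Set} (xs : List A) (p : A → Bool) (a : Carrier) →
                   a * fromℕ (countL xs p) ≈ sumList xs (λ x → when (p x) a)
  *-fromℕ-countL []       p a = zeroʳ a
  *-fromℕ-countL (x ∷ xs) p a with p x
  ... | true  = ≈-trans (distribˡ a 1# _) (+-cong (*-identityʳ a) (*-fromℕ-countL xs p a))
  ... | false = ≈-trans (*-fromℕ-countL xs p a) (≈-sym (+-identityˡ _))

  prodFin-cong : ∀ {m} {f g : Fin m → Carrier} → (∀ i → f i ≈ g i) → prodFin f ≈ prodFin g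
  prodFin-cong {zero}  h = ≈-refl
  prodFin-cong {suc m} h = *-cong (h zero) (prodFin-cong (h ∘ suc))

  prodFin-* : ∀ {m} (f g : Fin m → Carrier) → prodFin (λ i → f i * g i) ≈ prodFin f * prodFin g
  prodFin-* {zero}  f g = ≈-sym (*-identityʳ 1#)
  prodFin-* {suc m} f g = ≈-trans (*-cong ≈-refl (prodFin-* (f ∘ suc) (g ∘ suc))) (*-interchange _ _ _ _)

  prodFin-ones : ∀ {m} {f : Fin m → Carrier} → (∀ i → f i ≈ 1#) → prodFin f ≈ 1#
  prodFin-ones {zero}  h = ≈-refl
  prodFin-ones {suc m} h = ≈-trans (*-cong (h zero) (prodFin-ones (h ∘ suc))) (*-identityʳ 1#)

  prodFin-swap : ∀ {m k} (g : Fin m → Fin k → Carrier) →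
                 prodFin (λ i → prodFin (g i)) ≈ prodFin (λ j → prodFin (λ i → g i j))
  prodFin-swap {zero}  {k} g = ≈-sym (prodFin-ones {k} λ _ → ≈-refl)
  prodFin-swap {suc m} g = ≈-trans (*-cong ≈-refl (prodFin-swap (g ∘ suc))) (≈-sym (prodFin-* (g zero) _))

  prodFin-zero : ∀ {m} (f : Fin m → Carrier) i → f i ≈ 0# → prodFin f ≈ 0#
  prodFin-zero {suc m} f zero    z = ≈-trans (*-cong z ≈-refl) (zeroˡ _)
  prodFin-zero {suc m} f (suc i) z = ≈-trans (*-cong ≈-refl (prodFin-zero (f ∘ suc) i z)) (zeroʳ _)

  prodFin-pow : ∀ {m} (a : Carrier) (A : Fin m → Bool) →
                prodFin (λ i → if A i then a else 1#) ≈ pow a (count A)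
  prodFin-pow {zero}  a A = ≈-refl
  prodFin-pow {suc m} a A with A zero
  ... | true  = *-cong ≈-refl (prodFin-pow a (A ∘ suc))
  ... | false = ≈-trans (*-identityˡ _) (prodFin-pow a (A ∘ suc))

  product-of-sums : ∀ {A : Set} m (xs : List A) (g : Fin m → A → Carrier) →
                    prodFin (λ i → sumList xs (g i)) ≈ sumList (allFuns m xs) (λ φ → prodFin (λ i → g i (φ i)))
  product-of-sums zero    xs g = ≈-sym (+-identityʳ 1#)
  product-of-sums {A} (suc m) xs g = begin
    sumList xs (g zero) * prodFin (λ i → sumList xs (g (suc i)))
      ≈⟨ *-cong ≈-refl (product-of-sums m xs (g ∘ suc)) ⟩
    sumList xs (g zero) * sumList φs rest
      ≈⟨ sumList-*ʳ xs _ (g zero) ⟩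
    sumList xs (λ x → g zero x * sumList φs rest)
      ≈⟨ sumList-cong xs (λ x → sumList-*ˡ φs (g zero x) rest) ⟩
    sumList xs (λ x → sumList φs (λ φ → g zero x * rest φ))
      ≈⟨ sumList-concatMap xs φs _ (λ φ → prodFin (λ i → g i (φ i))) ⟨
    sumList (allFuns (suc m) xs) (λ φ → prodFin (λ i → g i (φ i))) ∎
    where
    φs = allFuns m xs
    rest : (Fin m → A) → Carrier
    rest φ = prodFin (λ i → g (suc i) (φ i))

  sgn-square : ∀ k → sgn k * sgn k ≈ 1#
  sgn-square zero    = *-identityˡ 1#
  sgn-square (suc k) = begin
    (- sgn k) * (- sgn k) ≈⟨ -‿distribʳ-* (- sgn k) (sgn k) ⟨
    - ((- sgn k) * sgn k) ≈⟨ -‿cong (-‿distribˡ-* (sgn k) (sgn k)) ⟨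
    - (- (sgn k * sgn k)) ≈⟨ -‿involutive _ ⟩
    sgn k * sgn k         ≈⟨ sgn-square k ⟩
    1#                    ∎

  sgn-cancel : ∀ k w x → sgn k * (w * (sgn k * x)) ≈ w * x
  sgn-cancel k w x = begin
    s * (w * (s * x)) ≈⟨ *-assoc s w _ ⟨
    (s * w) * (s * x) ≈⟨ *-cong (*-comm s w) ≈-refl ⟩
    (w * s) * (s * x) ≈⟨ *-assoc w s _ ⟩
    w * (s * (s * x)) ≈⟨ *-cong ≈-refl (*-assoc s s x) ⟨
    w * ((s * s) * x) ≈⟨ *-cong ≈-refl (*-cong (sgn-square k) ≈-refl) ⟩
    w * (1# * x)      ≈⟨ *-cong ≈-refl (*-identityˡ x) ⟩
    w * x             ∎
    where
    s = sgn k

  -- "xs contains exactly one element satisfying P", phrased through sums: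
  -- any h equal to a on P and vanishing off P sums to a over xs.
  ExactlyOnce : ∀ {A : Set} → List A → (A → Set) → Set (c ⊔ ℓ)
  ExactlyOnce {A} xs P = ∀ (h : A → Carrier) a →
    (∀ x → P x → h x ≈ a) → (∀ x → ¬ P x → h x ≈ 0#) → sumList xs h ≈ a

  ExactlyOnce-⇔ : ∀ {A : Set} {xs : List A} {P Q : A → Set} →
                  (∀ x → P x → Q x) → (∀ x → Q x → P x) → ExactlyOnce xs P → ExactlyOnce xs Q
  ExactlyOnce-⇔ P⇒Q Q⇒P once h a onQ offQ =
    once h a (λ x p → onQ x (P⇒Q x p)) (λ x ¬p → offQ x (λ q → ¬p (Q⇒P x q)))

  ExactlyOnce-bool : ∀ b₀ → ExactlyOnce (true ∷ false ∷ []) (_≡ b₀)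
  ExactlyOnce-bool true  h a on off =
    ≈-trans (+-cong (on true refl) (≈-trans (+-cong (off false λ ()) ≈-refl) (+-identityʳ 0#))) (+-identityʳ a)
  ExactlyOnce-bool false h a on off =
    ≈-trans (+-cong (off true λ ()) (≈-trans (+-cong (on false refl) ≈-refl) (+-identityʳ a))) (+-identityˡ a)

  sumList-tabulate-zero : ∀ {m} {B : Set} (f : Fin m → B) (h : B → Carrier) →
                          (∀ i → h (f i) ≈ 0#) → sumList (tabulate f) h ≈ 0#
  sumList-tabulate-zero {zero}  f h z = ≈-refl
  sumList-tabulate-zero {suc m} f h z =
    ≈-trans (+-cong (z zero) (sumList-tabulate-zero (f ∘ suc) h (z ∘ suc))) (+-identityʳ 0#)

  ExactlyOnce-tabulate : ∀ {m} {B : Set} (f : Fin m → B) → (∀ {i j} → f i ≡ f j → i ≡ j) →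
                         ∀ i₀ → ExactlyOnce (tabulate f) (_≡ f i₀)
  ExactlyOnce-tabulate {suc m} f inj zero h a on off =
    ≈-trans (+-cong (on _ refl) (sumList-tabulate-zero (f ∘ suc) h λ i → off _ λ e → suc≢zero (inj e)))
            (+-identityʳ a)
    where
    suc≢zero : ∀ {i : Fin m} → ¬ (suc i ≡ zero)
    suc≢zero ()
  ExactlyOnce-tabulate {suc m} f inj (suc i₀) h a on off =
    ≈-trans (+-cong (off _ λ e → zero≢suc (inj e))
                    (ExactlyOnce-tabulate (f ∘ suc) (λ e → suc-injective (inj e)) i₀ h a on off))
            (+-identityˡ a)
    where
    zero≢suc : ¬ (zero ≡ suc i₀)
    zero≢suc ()

  ExactlyOnce-allFin : ∀ m (i₀ : Fin m) → ExactlyOnce (allFin m) (_≡ i₀)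
  ExactlyOnce-allFin m = ExactlyOnce-tabulate (λ i → i) (λ e → e)

  ExactlyOnce-allFuns : ∀ {A : Set} m (xs : List A) (P : Fin m → A → Set) →
                        (∀ i → ExactlyOnce xs (P i)) → ExactlyOnce (allFuns m xs) (λ φ → ∀ i → P i (φ i))
  ExactlyOnce-allFuns zero    xs P once h a on off = ≈-trans (+-cong (on _ λ ()) ≈-refl) (+-identityʳ a)
  ExactlyOnce-allFuns (suc m) xs P once h a on off =
    ≈-trans (sumList-concatMap xs (allFuns m xs) _ h)
      (once zero _ a
        (λ x px → ExactlyOnce-allFuns m xs (P ∘ suc) (once ∘ suc) _ a
                    (λ φ pφ → on _ λ { zero → px ; (suc i) → pφ i })
                    (λ φ ¬pφ → off _ λ all → ¬pφ (all ∘ suc)))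
        (λ x ¬px → sumList-zero (allFuns m xs) λ φ → off _ λ all → ¬px (all zero)))

  whenDec : ∀ {Q : Set} → Dec Q → Carrier → Carrier
  whenDec (yes _) x = x
  whenDec (no _)  x = 0#

  reindex : ∀ {A B : Set} (xs : List A) (ys : List B) (Rel : A → B → Set) →
            (∀ x y → Dec (Rel x y)) →
            (∀ x → ExactlyOnce ys (Rel x)) → (∀ y → ExactlyOnce xs (λ x → Rel x y)) →
            (f : A → Carrier) (g : B → Carrier) → (∀ x y → Rel x y → f x ≈ g y) →
            sumList xs f ≈ sumList ys g
  reindex {A} {B} xs ys Rel Rel? onceY onceX f g agree = begin
    sumList xs f                                          ≈⟨ sumList-cong xs expand ⟨
    sumList xs (λ x → sumList ys (λ y → term x y))        ≈⟨ sumList-swap xs ys term ⟩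
    sumList ys (λ y → sumList xs (λ x → term x y))        ≈⟨ sumList-cong ys collapse ⟩
    sumList ys g                                          ∎
    where
    term : A → B → Carrier
    term x y = whenDec (Rel? x y) (f x)

    term-related : ∀ x y → Rel x y → term x y ≈ f x
    term-related x y r with Rel? x y
    ... | yes _ = ≈-refl
    ... | no ¬r = ⊥-elim (¬r r)

    term-unrelated : ∀ x y → ¬ Rel x y → term x y ≈ 0#
    term-unrelated x y ¬r with Rel? x y
    ... | yes r = ⊥-elim (¬r r)
    ... | no _  = ≈-refl

    expand : ∀ x → sumList ys (term x) ≈ f x
    expand x = onceY x (term x) (f x) (term-related x) (term-unrelated x)

    collapse : ∀ y → sumList xs (λ x → term x y) ≈ g y
    collapse y = onceX y (λ x → term x y) (g y)
      (λ x r → ≈-trans (term-related x y r) (agree x y r)) (λ x ¬r → term-unrelated x y ¬r)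

module NetworkFacts {c ℓ} {R : CommutativeRing c ℓ} {n : ℕ} (N : Network R n) where
  open Network N
  open import Data.Fin using (fromℕ<)
  open import Data.Fin.Properties using (toℕ-fromℕ<)
  open import Data.Nat.Properties using (≤-trans)

  boundary-edge-unique : ∀ j e e′ → incBd N e j ≡ true → incBd N e′ j ≡ true → e ≡ e′
  boundary-edge-unique j = count≤1⇒unique (bdry≤1 j)

  ∂-at-edge : ∀ (π : Sub nE) j e → incBd N e j ≡ true → ∂ N π j ≡ π e
  ∂-at-edge π j e t with π e in πe
  ... | true  = nonzero⇒not==0 (count-pos {f = λ e′ → π e′ ∧ incBd N e′ j} e (∧-intro πe t))
  ... | false = cong (λ x → not (x == 0)) (count-allFalse λ e′ → ¬true⇒false λ q →
                  true≢false (P.trans (P.sym (∧-elimˡ {π e′} q))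
                    (P.trans (cong π (boundary-edge-unique j e′ e (∧-elimʳ {π e′} q) t)) πe)))

  ∂-without-edge : ∀ (π : Sub nE) j → (∀ e → incBd N e j ≡ false) → ∂ N π j ≡ false
  ∂-without-edge π j none = cong (λ x → not (x == 0)) (count-allFalse λ e → ¬true⇒false λ q →
    true≢false (P.trans (P.sym (∧-elimʳ {π e} q)) (none e)))

  dimer-white : ∀ {π} → isDimer N π ≡ true → ∀ v → count (λ e → π e ∧ incW N e v) ≡ 1
  dimer-white d v = ==⇒≡ (allB-elim (∧-elimˡ d) v)

  dimer-black : ∀ {π} → isDimer N π ≡ true → ∀ v → count (λ e → π e ∧ incB N e v) ≡ 1
  dimer-black {π} d v =
    ==⇒≡ (allB-elim (∧-elimˡ (∧-elimʳ {allB (λ w → count (λ e → π e ∧ incW N e w) == 1)} d)) v)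

  -- covering every interior vertex once suffices: the boundary condition of
  -- a dimer configuration holds automatically since boundary degrees are ≤ 1
  dimer-intro : ∀ {π} → (∀ v → count (λ e → π e ∧ incW N e v) ≡ 1) →
                (∀ v → count (λ e → π e ∧ incB N e v) ≡ 1) → isDimer N π ≡ true
  dimer-intro {π} whiteOnce blackOnce =
    ∧-intro (allB-intro (≡⇒== ∘ whiteOnce))
      (∧-intro (allB-intro (≡⇒== ∘ blackOnce))
        (allB-intro λ j → ≤⇒≤ᵇ (≤-trans (count-mono λ e q → ∧-elimʳ {π e} q) (bdry≤1 j))))

  degree-at-edge : ∀ r (M : Mult N r) j e → incBd N e j ≡ true → degW N r M j ≡ mult N r M e
  degree-at-edge r M j e t =
    sumℕ-filter-single {p = λ e′ → incBd N e′ j} (mult N r M) e t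
      (λ e′ t′ → boundary-edge-unique j e′ e t′ t)

  degree-without-edge : ∀ r (M : Mult N r) j → (∀ e → incBd N e j ≡ false) → degW N r M j ≡ 0
  degree-without-edge r M j = sumℕ-filter-none {p = λ e → incBd N e j} (mult N r M)

  module _ (r : ℕ) where

    multOf : (Fin nE → Sub r) → Mult N r
    multOf L e = fromℕ< (s≤s (count≤size (L e)))

    mult-multOf : ∀ L e → mult N r (multOf L) e ≡ count (L e)
    mult-multOf L e = toℕ-fromℕ< (s≤s (count≤size (L e)))

    -- if every label i ∈ [r] occurs on exactly one edge of a vertex, the
    -- multiplicities at that vertex sum to r: both sides count pairs (e, i)
    labels-once⇒degree-r : ∀ L (inc : Fin nE → Bool) → (∀ i → count (λ e → inc e ∧ L e i) ≡ 1) →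
                           sumℕ (λ e → if inc e then mult N r (multOf L) e else 0) ≡ r
    labels-once⇒degree-r L inc once = begin
      sumℕ (λ e → if inc e then mult N r (multOf L) e else 0)
        ≡⟨ sumℕ-cong (λ e → cong (λ x → if inc e then x else 0) (mult-multOf L e)) ⟩
      sumℕ (λ e → if inc e then count (L e) else 0)
        ≡⟨ sumℕ-cong (λ e → if-count (inc e) (L e)) ⟩
      sumℕ (λ e → count (λ i → inc e ∧ L e i))
        ≡⟨ sumℕ-cong (λ e → count≡sumℕ (λ i → inc e ∧ L e i)) ⟩
      sumℕ (λ e → sumℕ (λ i → ind (inc e ∧ L e i)))
        ≡⟨ sumℕ-swap (λ e i → ind (inc e ∧ L e i)) ⟩
      sumℕ (λ i → sumℕ (λ e → ind (inc e ∧ L e i)))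
        ≡⟨ sumℕ-cong (λ i → P.trans (P.sym (count≡sumℕ (λ e → inc e ∧ L e i))) (once i)) ⟩
      sumℕ {r} (λ _ → 1)
        ≡⟨ sumℕ-ones ⟩
      r ∎
      where open P.≡-Reasoning

    consistent-mult : ∀ {M L} → isConsistent N r M L ≡ true → ∀ e → count (L e) ≡ mult N r M e
    consistent-mult h e = ==⇒≡ (allB-elim (∧-elimˡ h) e)

    consistent-white : ∀ {M L} → isConsistent N r M L ≡ true →
                       ∀ v i → count (λ e → incW N e v ∧ L e i) ≡ 1
    consistent-white {M} {L} h v i =
      ==⇒≡ (allB-elim (allB-elim (∧-elimˡ (∧-elimʳ {allB (λ e → count (L e) == mult N r M e)} h)) v) i)

    consistent-black : ∀ {M L} → isConsistent N r M L ≡ true →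
                       ∀ v i → count (λ e → incB N e v ∧ L e i) ≡ 1
    consistent-black {M} {L} h v i =
      ==⇒≡ (allB-elim (allB-elim (∧-elimʳ (∧-elimʳ {allB (λ e → count (L e) == mult N r M e)} h)) v) i)

    consistent-intro : ∀ {L} → (∀ v i → count (λ e → incW N e v ∧ L e i) ≡ 1) →
                       (∀ v i → count (λ e → incB N e v ∧ L e i) ≡ 1) →
                       isConsistent N r (multOf L) L ≡ true
    consistent-intro {L} whiteOnce blackOnce =
      ∧-intro (allB-intro λ e → ≡⇒== (P.sym (mult-multOf L e)))
        (∧-intro (allB-intro λ v → allB-intro (≡⇒== ∘ whiteOnce v))
                 (allB-intro λ v → allB-intro (≡⇒== ∘ blackOnce v)))

    weblike-intro : ∀ {L} → (∀ v i → count (λ e → incW N e v ∧ L e i) ≡ 1) →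
                    (∀ v i → count (λ e → incB N e v ∧ L e i) ≡ 1) →
                    isWeblike N r (multOf L) ≡ true
    weblike-intro {L} whiteOnce blackOnce =
      ∧-intro (allB-intro λ v → ≡⇒== (labels-once⇒degree-r L (λ e → incW N e v) (whiteOnce v)))
              (allB-intro λ v → ≡⇒== (labels-once⇒degree-r L (λ e → incB N e v) (blackOnce v)))

    AgreesOnBoundary : (Fin n → Sub r) → (Fin nE → Sub r) → Set
    AgreesOnBoundary S L = ∀ j e → incBd N e j ≡ true → ∀ i → L e i ≡ S j i

    matches-elim : ∀ {S L} → matchesBdry N r S L ≡ true → AgreesOnBoundary S L
    matches-elim h j e t = eqSub-elim (if-true⇒ t (allB-elim (allB-elim h j) e))

    matches-intro : ∀ {S L} → AgreesOnBoundary S L → matchesBdry N r S L ≡ true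
    matches-intro {S} {L} agree = allB-intro λ j → allB-intro λ e → at-edge j e
      where
      at-edge : ∀ j e → (if incBd N e j then eqSub (L e) (S j) else true) ≡ true
      at-edge j e with incBd N e j in t
      ... | true  = eqSub-intro (agree j e t)
      ... | false = refl

module Correspondence {c ℓ} (R : CommutativeRing c ℓ) {n : ℕ} (N : Network R n) (r : ℕ)
  (lam : Fin n → ℕ) (S : Fin n → Sub r) (|S|≡λ : ∀ j → count (S j) ≡ lam j) where
  open Network N
  open NetworkFacts N
  open CommutativeRing R hiding (zero)
    renaming (refl to ≈-refl; sym to ≈-sym; trans to ≈-trans)
  open RingOps R
  open RingSums R
  import Relation.Binary.Reasoning.Setoid as ≈-Reasoning
  open import Data.Bool.Properties using (∧-comm; not-injective)

  Transposed : (Fin r → Sub nE) → (Fin nE → Sub r) → Set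
  Transposed Π L = ∀ i e → Π i e ≡ L e i

  dimerFor : (Fin r → Sub nE) → Fin r → Bool
  dimerFor Π i = isDimer N (Π i) ∧ eqSub (∂ N (Π i)) (dual S i)

  webFor : (Fin nE → Sub r) → Bool
  webFor L = isWeblike N r (multOf r L) ∧ eqDeg N r (degW N r (multOf r L)) lam

  labelingFor : (Fin nE → Sub r) → Bool
  labelingFor L = isConsistent N r (multOf r L) L ∧ matchesBdry N r S L

  module _ {Π : Fin r → Sub nE} {L : Fin nE → Sub r} (t : Transposed Π L) where

    coverage-transposed : ∀ (inc : Fin nE → Bool) i →
                          count (λ e → Π i e ∧ inc e) ≡ count (λ e → inc e ∧ L e i)
    coverage-transposed inc i = count-cong λ e → P.trans (cong (_∧ inc e) (t i e)) (∧-comm (L e i) (inc e))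

    ∂-transposed : ∀ i j e → incBd N e j ≡ true → ∂ N (Π i) j ≡ L e i
    ∂-transposed i j e b = P.trans (∂-at-edge (Π i) j e b) (t i e)

    boundary-sound : (∀ i j → ∂ N (Π i) j ≡ S j i) →
                     AgreesOnBoundary r S L × (∀ j → degW N r (multOf r L) j ≡ lam j)
    boundary-sound ∂≡S = agree , degree
      where
      agree : AgreesOnBoundary r S L
      agree j e b i = P.trans (P.sym (∂-transposed i j e b)) (∂≡S i j)

      degree : ∀ j → degW N r (multOf r L) j ≡ lam j
      degree j with find (λ e → incBd N e j)
      ... | inj₁ (e , b) = begin
        degW N r (multOf r L) j  ≡⟨ degree-at-edge r (multOf r L) j e b ⟩
        mult N r (multOf r L) e  ≡⟨ mult-multOf r L e ⟩
        count (L e)              ≡⟨ count-cong (agree j e b) ⟩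
        count (S j)              ≡⟨ |S|≡λ j ⟩
        lam j                    ∎
        where open P.≡-Reasoning
      ... | inj₂ none = begin
        degW N r (multOf r L) j  ≡⟨ degree-without-edge r (multOf r L) j none ⟩
        0                        ≡⟨ count-allFalse (λ i → P.trans (P.sym (∂≡S i j)) (∂-without-edge (Π i) j none)) ⟨
        count (S j)              ≡⟨ |S|≡λ j ⟩
        lam j                    ∎
        where open P.≡-Reasoning

    boundary-complete : AgreesOnBoundary r S L → (∀ j → degW N r (multOf r L) j ≡ lam j) →
                        ∀ i j → ∂ N (Π i) j ≡ S j i
    boundary-complete agree degree i j with find (λ e → incBd N e j)
    ... | inj₁ (e , b) = P.trans (∂-transposed i j e b) (agree j e b i)
    ... | inj₂ none    = P.trans (∂-without-edge (Π i) j none) (P.sym (count≡0⇒false |S_j|≡0 i))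
      where
      |S_j|≡0 : count (S j) ≡ 0
      |S_j|≡0 = P.trans (|S|≡λ j) (P.trans (P.sym (degree j)) (degree-without-edge r (multOf r L) j none))

    sound : (∀ i → dimerFor Π i ≡ true) → webFor L ≡ true × labelingFor L ≡ true
    sound dimers = ∧-intro (weblike-intro r labels-at-white labels-at-black) (allB-intro (≡⇒== ∘ degree))
                 , ∧-intro (consistent-intro r labels-at-white labels-at-black) (matches-intro r agree)
      where
      labels-at-white : ∀ v i → count (λ e → incW N e v ∧ L e i) ≡ 1
      labels-at-white v i = P.trans (P.sym (coverage-transposed (λ e → incW N e v) i))
                                    (dimer-white (∧-elimˡ (dimers i)) v)
      labels-at-black : ∀ v i → count (λ e → incB N e v ∧ L e i) ≡ 1
      labels-at-black v i = P.trans (P.sym (coverage-transposed (λ e → incB N e v) i))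
                                    (dimer-black (∧-elimˡ (dimers i)) v)
      ∂≡S : ∀ i j → ∂ N (Π i) j ≡ S j i
      ∂≡S i = eqSub-elim (∧-elimʳ {isDimer N (Π i)} (dimers i))
      agree : AgreesOnBoundary r S L
      agree = proj₁ (boundary-sound ∂≡S)
      degree : ∀ j → degW N r (multOf r L) j ≡ lam j
      degree = proj₂ (boundary-sound ∂≡S)

    complete : webFor L ≡ true → labelingFor L ≡ true → ∀ i → dimerFor Π i ≡ true
    complete web labeling i =
      ∧-intro (dimer-intro (λ v → P.trans (coverage-transposed (λ e → incW N e v) i)
                                         (consistent-white r consistent v i))
                           (λ v → P.trans (coverage-transposed (λ e → incB N e v) i)
                                         (consistent-black r consistent v i)))
              (eqSub-intro (boundary-complete agree degree i))
      where
      consistent : isConsistent N r (multOf r L) L ≡ true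
      consistent = ∧-elimˡ labeling
      agree : AgreesOnBoundary r S L
      agree = matches-elim r (∧-elimʳ {isConsistent N r (multOf r L) L} labeling)
      degree : ∀ j → degW N r (multOf r L) j ≡ lam j
      degree j = ==⇒≡ (allB-elim (∧-elimʳ {isWeblike N r (multOf r L)} web) j)

    weight-transposed : prodFin (λ i → wtSet N (Π i)) ≈ wtW N r (multOf r L)
    weight-transposed = begin
      prodFin (λ i → prodFin (λ e → if Π i e then wt e else 1#))
        ≈⟨ prodFin-swap (λ i e → if Π i e then wt e else 1#) ⟩
      prodFin (λ e → prodFin (λ i → if Π i e then wt e else 1#))
        ≈⟨ prodFin-cong (λ e → prodFin-cong λ i → reflexive (cong (λ b → if b then wt e else 1#) (t i e))) ⟩
      prodFin (λ e → prodFin (λ i → if L e i then wt e else 1#))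
        ≈⟨ prodFin-cong (λ e → prodFin-pow (wt e) (L e)) ⟩
      prodFin (λ e → pow (wt e) (count (L e)))
        ≈⟨ prodFin-cong (λ e → reflexive (cong (pow (wt e)) (P.sym (mult-multOf r L e)))) ⟩
      wtW N r (multOf r L) ∎
      where open ≈-Reasoning setoid

    term-transposed : prodFin (λ i → when (dimerFor Π i) (wtSet N (Π i))) ≈
                      when (webFor L) (when (labelingFor L) (wtW N r (multOf r L)))
    term-transposed with find (λ i → not (dimerFor Π i))
    ... | inj₂ allDimers = begin
      prodFin (λ i → when (dimerFor Π i) (wtSet N (Π i)))
        ≈⟨ prodFin-cong (λ i → reflexive (when-true (dimer i))) ⟩
      prodFin (λ i → wtSet N (Π i))
        ≈⟨ weight-transposed ⟩
      wtW N r (multOf r L)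
        ≡⟨ P.sym (P.trans (cong (λ b → when b _) web) (when-true labeling)) ⟩
      when (webFor L) (when (labelingFor L) (wtW N r (multOf r L))) ∎
      where
      open ≈-Reasoning setoid
      dimer : ∀ i → dimerFor Π i ≡ true
      dimer i = not-injective (allDimers i)
      web : webFor L ≡ true
      web = proj₁ (sound dimer)
      labeling : labelingFor L ≡ true
      labeling = proj₂ (sound dimer)
    ... | inj₁ (i , notDimer) =
      ≈-trans (prodFin-zero _ i (reflexive (when-false (not-injective notDimer))))
              (≈-sym (reflexive vanishes))
      where
      vanishes : when (webFor L) (when (labelingFor L) (wtW N r (multOf r L))) ≡ 0#
      vanishes with webFor L in web | labelingFor L in labeling
      ... | true  | true  = ⊥-elim (true≢false (P.trans (P.sym (complete web labeling i))
                                                         (not-injective notDimer)))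
      ... | true  | false = refl
      ... | false | _     = refl

module WebExpansion {c ℓ} (R : CommutativeRing c ℓ) {n : ℕ} (N : Network R n) (r : ℕ)
  (lam : Fin n → ℕ) (S : Fin n → Sub r) (|S|≡λ : ∀ j → count (S j) ≡ lam j) where
  open Network N
  open NetworkFacts N
  open Correspondence R N r lam S |S|≡λ
  open CommutativeRing R hiding (zero)
    renaming (refl to ≈-refl; sym to ≈-sym; trans to ≈-trans)
  open RingOps R
  open RingSums R
  open import Relation.Binary.Reasoning.Setoid setoid
  open import Data.Fin.Properties using (toℕ-injective; all?)
  import Data.Bool.Properties as Bool

  degreeAt : (Fin nE → Bool) → Mult N r → ℕ
  degreeAt inc M = sumℕ (λ e → if inc e then mult N r M e else 0)

  degreeAt-cong : ∀ inc {M M′} → (∀ e → mult N r M e ≡ mult N r M′ e) → degreeAt inc M ≡ degreeAt inc M′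
  degreeAt-cong inc eq = sumℕ-cong λ e → cong (λ x → if inc e then x else 0) (eq e)

  webTerm : (Fin nE → Sub r) → Mult N r → Carrier
  webTerm L M = when (isWeblike N r M ∧ eqDeg N r (degW N r M) lam)
                     (when (isConsistent N r M L ∧ matchesBdry N r S L) (wtW N r M))

  webTerm-cong : ∀ L {M M′} → (∀ e → mult N r M e ≡ mult N r M′ e) → webTerm L M ≈ webTerm L M′
  webTerm-cong L {M} {M′} eq =
    when-cong (cong₂ _∧_ (cong₂ _∧_ (allB-cong λ v → cong (_== r) (degreeAt-cong (λ e → incW N e v) eq))
                                    (allB-cong λ v → cong (_== r) (degreeAt-cong (λ e → incB N e v) eq)))
                         (allB-cong λ j → cong (_== lam j) (degreeAt-cong (λ e → incBd N e j) eq)))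
      (when-cong (cong (_∧ matchesBdry N r S L) (cong (_∧ _) (allB-cong λ e → cong (count (L e) ==_) (eq e))))
                 (prodFin-cong λ e → reflexive (cong (pow (wt e)) (eq e))))

  webTerm-other : ∀ L M → ¬ (∀ e → M e ≡ multOf r L e) → webTerm L M ≈ 0#
  webTerm-other L M M≢ with isWeblike N r M ∧ eqDeg N r (degW N r M) lam
                          | isConsistent N r M L ∧ matchesBdry N r S L in labeling
  ... | false | _     = ≈-refl
  ... | true  | false = ≈-refl
  ... | true  | true  = ⊥-elim (M≢ λ e → toℕ-injective
          (P.trans (P.sym (consistent-mult r (∧-elimˡ labeling) e)) (P.sym (mult-multOf r L e))))

  Webs : List (Mult N r)
  Webs = allFuns nE (allFin (suc r))

  Labelings : List (Fin nE → Sub r)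
  Labelings = allFuns nE (allSubs r)

  sum-over-webs : ∀ L → sumList Webs (webTerm L) ≈ when (webFor L) (when (labelingFor L) (wtW N r (multOf r L)))
  sum-over-webs L =
    ExactlyOnce-allFuns nE (allFin (suc r)) (λ e x → x ≡ multOf r L e)
      (λ e → ExactlyOnce-allFin (suc r) (multOf r L e))
      (webTerm L) _ (λ M M≡ → webTerm-cong L (λ e → cong toℕ (M≡ e))) (webTerm-other L)

  sum-over-labelings : ∀ M → sumList Labelings (λ L → webTerm L M) ≈
    signL N r S * when (isWeblike N r M ∧ eqDeg N r (degW N r M) lam) (wtW N r M * webVal N r M S)
  sum-over-labelings M with isWeblike N r M ∧ eqDeg N r (degW N r M) lam
  ... | false = ≈-trans (sumList-zero Labelings λ _ → ≈-refl) (≈-sym (zeroʳ _))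
  ... | true  = begin
    sumList Labelings (λ L → when (isConsistent N r M L ∧ matchesBdry N r S L) (wtW N r M))
      ≈⟨ *-fromℕ-countL Labelings (λ L → isConsistent N r M L ∧ matchesBdry N r S L) (wtW N r M) ⟨
    wtW N r M * fromℕ (aCount N r S M)
      ≈⟨ sgn-cancel (inv (concatFam (λ j → listing (S j)))) (wtW N r M) _ ⟨
    signL N r S * (wtW N r M * webVal N r M S) ∎

  Tuples : List (Fin r → Sub nE)
  Tuples = allFuns r (allSubs nE)

  Transposed? : ∀ Π L → Dec (Transposed Π L)
  Transposed? Π L = all? λ i → all? λ e → Π i e Bool.≟ L e i

  transpose-of-tuple : ∀ Π → ExactlyOnce Labelings (Transposed Π)
  transpose-of-tuple Π =
    ExactlyOnce-⇔ {xs = Labelings} (λ L t i e → t e i) (λ L t e i → t i e)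
      (ExactlyOnce-allFuns nE (allSubs r) (λ e l → ∀ i → Π i e ≡ l i) λ e →
        ExactlyOnce-⇔ {xs = allSubs r} (λ l t i → P.sym (t i)) (λ l t i → P.sym (t i))
          (ExactlyOnce-allFuns r (true ∷ false ∷ []) (λ i b → b ≡ Π i e) (λ i → ExactlyOnce-bool (Π i e))))

  transpose-of-labeling : ∀ L → ExactlyOnce Tuples (λ Π → Transposed Π L)
  transpose-of-labeling L =
    ExactlyOnce-allFuns r (allSubs nE) (λ i π → ∀ e → π e ≡ L e i) λ i →
      ExactlyOnce-allFuns nE (true ∷ false ∷ []) (λ e b → b ≡ L e i) (λ e → ExactlyOnce-bool (L e i))

  expansion : prodFin (λ i → Δ N (dual S i)) ≈ signL N r S * WebEval N r lam S
  expansion = begin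
    prodFin (λ i → Δ N (dual S i))
      ≈⟨ product-of-sums r (allSubs nE) (λ i π → when (isDimer N π ∧ eqSub (∂ N π) (dual S i)) (wtSet N π)) ⟩
    sumList Tuples (λ Π → prodFin (λ i → when (dimerFor Π i) (wtSet N (Π i))))
      ≈⟨ reindex Tuples Labelings Transposed Transposed? transpose-of-tuple transpose-of-labeling
                 _ _ (λ Π L t → term-transposed t) ⟩
    sumList Labelings (λ L → when (webFor L) (when (labelingFor L) (wtW N r (multOf r L))))
      ≈⟨ sumList-cong Labelings sum-over-webs ⟨
    sumList Labelings (λ L → sumList Webs (webTerm L))
      ≈⟨ sumList-swap Labelings Webs webTerm ⟩
    sumList Webs (λ M → sumList Labelings (λ L → webTerm L M))
      ≈⟨ sumList-cong Webs sum-over-labelings ⟩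
    sumList Webs (λ M → signL N r S *
      when (isWeblike N r M ∧ eqDeg N r (degW N r M) lam) (wtW N r M * webVal N r M S))
      ≈⟨ sumList-*ˡ Webs (signL N r S) _ ⟨
    signL N r S * WebEval N r lam S ∎

open import Data.Nat using (ℕ; _≤_; _+_; _*_)
open import Data.Fin using (Fin)
open import Algebra.Bundles using (CommutativeRing)
open import Relation.Binary.PropositionalEquality using (_≡_)

-- Proposition 5.5.  Of the hypotheses only |S_j| = λ_j (the first half of
-- "S has type λ") enters the identity; the others describe the setting.
proposition5p5 : ∀ {c ℓ} (R : CommutativeRing c ℓ) {n : ℕ} (N : Network R n)
    (k r : ℕ) (lam : Fin n → ℕ) (S : Fin n → Sub r) →
    HasDimer N →
    Network.nW N ≡ Network.nB N + k →
    1 ≤ r →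
    (∀ j → lam j ≤ r) →
    sumℕ lam ≡ k * r →
    IsListOfType S lam k →
    CommutativeRing._≈_ R
      (RingOps.prodFin R (λ i → Δ N (dual S i)))
      (CommutativeRing._*_ R (signL N r S) (WebEval N r lam S))
proposition5p5 R N k r lam S _ _ _ _ _ (|S|≡λ , _) = WebExpansion.expansion R N r lam S |S|≡λ
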